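{- Let $\mathcal C$ be a tidy LD category, let $\mathfrak f$ be a set of morphisms of $\mathcal C$ whose targets are $\otimes$-products, let $u\in\mathfrak Y$ be non-empty, $f\in\mathfrak f$, $\vec A\in\mathcal C^{|u|}$, and let $h$ be a morphism with target $H^f_u(\vec A)$ such that $\tau^f_u(\vec A)\circ h$ is not $\mathfrak f$-analysable. Then: (i) $h$ is not a component of $\delta^l$, $\delta^r$, $\bar\alpha$ or $\bar\alpha^{ -1}$, and not of the form $\mathrm{id}\odot h'$ or $h'\odot\mathrm{id}$ for any morphism $h'$. (ii) If $h$ is a component of $\alpha$ then $u=\alpha^{ -1}$; if $h$ is a component of $\alpha^{ -1}$ then $u=\alpha$. (iii) If $h=\mathrm{id}\otimes h'$ for some $h'$, then $\mathrm{ter}(u)=\alpha$ and $\tau^f_{\mathrm{init}(u)}(\vec A_{\ge2})\circ h'$ is not $\mathfrak f$-analysable. (iv) If $h=h'\otimes\mathrm{id}$ for some $h'$, then $\mathrm{ter}(u)=\alpha^{ -1}$ and $\tau^f_{\mathrm{init}(u)}(\vec A_{\le|u|-1})\circ h'$ is not $\mathfrak f$-analysable.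
   Context: $\mathcal C$ is a unitless LD category: bifunctors $\otimes,\odot$ (no units), natural isomorphisms $\alpha_{A,B,C}:A\otimes(B\otimes C)\to(A\otimes B)\otimes C$, $\bar\alpha_{A,B,C}:A\odot(B\odot C)\to(A\odot B)\odot C$, natural transformations $\delta^l_{A,B,C}:A\otimes(B\odot C)\to(A\otimes B)\odot C$, $\delta^r_{A,B,C}:(A\odot B)\otimes C\to A\odot(B\otimes C)$, satisfying (objects denote identities): (P1) $\alpha_{A\otimes B,C,D}\circ\alpha_{A,B,C\otimes D}=(\alpha_{A,B,C}\otimes D)\circ\alpha_{A,B\otimes C,D}\circ(A\otimes\alpha_{B,C,D})$; (P2) $\delta^l_{A\otimes B,C,D}\circ\alpha_{A,B,C\odot D}=(\alpha_{A,B,C}\odot D)\circ\delta^l_{A,B\otimes C,D}\circ(A\otimes\delta^l_{B,C,D})$; (P3) $\delta^l_{A,B,C\otimes D}\circ(A\otimes\delta^r_{B,C,D})=\delta^r_{A\otimes B,C,D}\circ(\delta^l_{A,B,C}\otimes D)\circ\alpha_{A,B\odot C,D}$; (P4) $\bar\alpha_{A\otimes B,C,D}\circ\delta^l_{A,B,C\odot D}=(\delta^l_{A,B,C}\odot D)\circ\delta^l_{A,B\odot C,D}\circ(A\otimes\bar\alpha_{B,C,D})$; (P5) $(A\odot\alpha_{B,C,D})\circ\delta^r_{A,B,C\otimes D}=\delta^r_{A,B\otimes C,D}\circ(\delta^r_{A,B,C}\otimes D)\circ\alpha_{A\odot B,C,D}$; (P6) $(\delta^r_{A,B,C}\odot D)\circ\delta^l_{A\odot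 B,C,D}=\bar\alpha_{A,B\otimes C,D}\circ(A\odot\delta^l_{B,C,D})\circ\delta^r_{A,B,C\odot D}$; (P7) $\delta^r_{A\odot B,C,D}\circ(\bar\alpha_{A,B,C}\otimes D)=\bar\alpha_{A,B,C\otimes D}\circ(A\odot\delta^r_{B,C,D})\circ\delta^r_{A,B\odot C,D}$; (P8) $\bar\alpha_{A\odot B,C,D}\circ\bar\alpha_{A,B,C\odot D}=(\bar\alpha_{A,B,C}\odot D)\circ\bar\alpha_{A,B\odot C,D}\circ(A\odot\bar\alpha_{B,C,D})$. Tidy: $A_1\otimes A_2=B_1\otimes B_2\Rightarrow A_i=B_i$, same for $\odot$, and $A_1\otimes A_2\ne B_1\odot B_2$. $\otimes$-product: object of the form $A_1\otimes A_2$. $\mathfrak Y$ is the free monoid on letters $\alpha,\alpha^{ -1}$; every non-empty word factors uniquely as $u=m\,\mathrm{init}(u)$ with $m=\mathrm{ter}(u)$ a letter (the letter applied last). For $\vec A=(A_1,\dots,A_n)$, $\vec A_{\ge k}=(A_k,\dots,A_n)$, $\vec A_{\le k}=(A_1,\dots,A_k)$. For $f:H\to L\otimes R$, $u\in\mathfrak Y$: $H^f_\emptyset=H$, $L^f_\emptyset=L$, $R^f_\emptyset=R$; $H^f_{\alpha u}(\vec A)=A_1\otimes H^f_u(\vec A_{\ge2})$, $L^f_{\alpha u}(\vec A)=A_1\otimes L^f_u(\vec A_{\ge2})$, $R^f_{\alpha u}(\vec A)=R^f_u(\vec A_{\ge2})$; $H^f_{\alpha^{ -1}u}(\vec A)=H^f_u(\vec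 A_{\le|u|})\otimes A_{|u|+1}$, $L^f_{\alpha^{ -1}u}(\vec A)=L^f_u(\vec A_{\le|u|})$, $R^f_{\alpha^{ -1}u}(\vec A)=R^f_u(\vec A_{\le|u|})\otimes A_{|u|+1}$; $\tau^f_u:H^f_u\to L^f_u\otimes R^f_u$ with $\tau^f_\emptyset=f$, $\tau^f_{\alpha u}=\alpha\circ(\mathrm{id}\otimes\tau^f_u)$, $\tau^f_{\alpha^{ -1}u}=\alpha^{ -1}\circ(\tau^f_u\otimes\mathrm{id})$ (evident components). A morphism $g$ is $\mathfrak f$-analysable if $g=(g'\otimes g'')\circ\tau^{f'}_v(\vec B)$ for some morphisms $g',g''$, some $f'\in\mathfrak f$, $v\in\mathfrak Y$, $\vec B\in\mathcal C^{|v|}$. -}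

module Defs where

open import Level using (Level; _⊔_; suc)
open import Data.Nat using (ℕ)
open import Data.List using (List; []; _∷_; length)
open import Data.Vec using (Vec; []; _∷_; init; last; tail)
open import Data.Product using (Σ; ∃; ∃-syntax; _×_; _,_)
open import Relation.Binary.PropositionalEquality using (_≡_)
open import Data.Empty using (⊥)

-- Unitless LD categories (strict categories: equality of morphisms is
-- propositional equality, as for set-theoretic categories).

record LDCat (o m : Level) : Set (suc (o ⊔ m)) where
  infixr 9 _∘_
  infixr 10 _⊗₀_ _⊗₁_ _⊙₀_ _⊙₁_
  field
    Obj : Set o
    Hom : Obj → Obj → Set m
    id  : ∀ {A} → Hom A A
    _∘_ : ∀ {A B C} → Hom B C → Hom A B → Hom A C
    assoc : ∀ {A B C D} (h : Hom C D) (g : Hom B C) (f : Hom A B) →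
            (h ∘ g) ∘ f ≡ h ∘ (g ∘ f)
    idˡ : ∀ {A B} (f : Hom A B) → id ∘ f ≡ f
    idʳ : ∀ {A B} (f : Hom A B) → f ∘ id ≡ f

    _⊗₀_ : Obj → Obj → Obj
    _⊗₁_ : ∀ {A B C D} → Hom A B → Hom C D → Hom (A ⊗₀ C) (B ⊗₀ D)
    ⊗-id : ∀ {A B} → id {A} ⊗₁ id {B} ≡ id
    ⊗-∘  : ∀ {A B C A' B' C'} (f : Hom B C) (g : Hom A B)
             (f' : Hom B' C') (g' : Hom A' B') →
           (f ∘ g) ⊗₁ (f' ∘ g') ≡ (f ⊗₁ f') ∘ (g ⊗₁ g')

    _⊙₀_ : Obj → Obj → Obj
    _⊙₁_ : ∀ {A B C D} → Hom A B → Hom C D → Hom (A ⊙₀ C) (B ⊙₀ D)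
    ⊙-id : ∀ {A B} → id {A} ⊙₁ id {B} ≡ id
    ⊙-∘  : ∀ {A B C A' B' C'} (f : Hom B C) (g : Hom A B)
             (f' : Hom B' C') (g' : Hom A' B') →
           (f ∘ g) ⊙₁ (f' ∘ g') ≡ (f ⊙₁ f') ∘ (g ⊙₁ g')

    α    : ∀ A B C → Hom (A ⊗₀ (B ⊗₀ C)) ((A ⊗₀ B) ⊗₀ C)
    α⁻¹  : ∀ A B C → Hom ((A ⊗₀ B) ⊗₀ C) (A ⊗₀ (B ⊗₀ C))
    α-nat : ∀ {A A' B B' C C'} (f : Hom A A') (g : Hom B B') (h : Hom C C') →
            α A' B' C' ∘ (f ⊗₁ (g ⊗₁ h)) ≡ ((f ⊗₁ g) ⊗₁ h) ∘ α A B C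
    α⁻¹∘α : ∀ A B C → α⁻¹ A B C ∘ α A B C ≡ id
    α∘α⁻¹ : ∀ A B C → α A B C ∘ α⁻¹ A B C ≡ id

    ᾱ    : ∀ A B C → Hom (A ⊙₀ (B ⊙₀ C)) ((A ⊙₀ B) ⊙₀ C)
    ᾱ⁻¹  : ∀ A B C → Hom ((A ⊙₀ B) ⊙₀ C) (A ⊙₀ (B ⊙₀ C))
    ᾱ-nat : ∀ {A A' B B' C C'} (f : Hom A A') (g : Hom B B') (h : Hom C C') →
            ᾱ A' B' C' ∘ (f ⊙₁ (g ⊙₁ h)) ≡ ((f ⊙₁ g) ⊙₁ h) ∘ ᾱ A B C
    ᾱ⁻¹∘ᾱ : ∀ A B C → ᾱ⁻¹ A B C ∘ ᾱ A B C ≡ id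
    ᾱ∘ᾱ⁻¹ : ∀ A B C → ᾱ A B C ∘ ᾱ⁻¹ A B C ≡ id

    δˡ : ∀ A B C → Hom (A ⊗₀ (B ⊙₀ C)) ((A ⊗₀ B) ⊙₀ C)
    δʳ : ∀ A B C → Hom ((A ⊙₀ B) ⊗₀ C) (A ⊙₀ (B ⊗₀ C))
    δˡ-nat : ∀ {A A' B B' C C'} (f : Hom A A') (g : Hom B B') (h : Hom C C') →
             δˡ A' B' C' ∘ (f ⊗₁ (g ⊙₁ h)) ≡ ((f ⊗₁ g) ⊙₁ h) ∘ δˡ A B C
    δʳ-nat : ∀ {A A' B B' C C'} (f : Hom A A') (g : Hom B B') (h : Hom C C') →
             δʳ A' B' C' ∘ ((f ⊙₁ g) ⊗₁ h) ≡ (f ⊙₁ (g ⊗₁ h)) ∘ δʳ A B C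

    P1 : ∀ A B C D →
         α (A ⊗₀ B) C D ∘ α A B (C ⊗₀ D)
         ≡ (α A B C ⊗₁ id {D}) ∘ α A (B ⊗₀ C) D ∘ (id {A} ⊗₁ α B C D)
    P2 : ∀ A B C D →
         δˡ (A ⊗₀ B) C D ∘ α A B (C ⊙₀ D)
         ≡ (α A B C ⊙₁ id {D}) ∘ δˡ A (B ⊗₀ C) D ∘ (id {A} ⊗₁ δˡ B C D)
    P3 : ∀ A B C D →
         δˡ A B (C ⊗₀ D) ∘ (id {A} ⊗₁ δʳ B C D)
         ≡ δʳ (A ⊗₀ B) C D ∘ (δˡ A B C ⊗₁ id {D}) ∘ α A (B ⊙₀ C) D
    P4 : ∀ A B C D →
         ᾱ (A ⊗₀ B) C D ∘ δˡ A B (C ⊙₀ D)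
         ≡ (δˡ A B C ⊙₁ id {D}) ∘ δˡ A (B ⊙₀ C) D ∘ (id {A} ⊗₁ ᾱ B C D)
    P5 : ∀ A B C D →
         (id {A} ⊙₁ α B C D) ∘ δʳ A B (C ⊗₀ D)
         ≡ δʳ A (B ⊗₀ C) D ∘ (δʳ A B C ⊗₁ id {D}) ∘ α (A ⊙₀ B) C D
    P6 : ∀ A B C D →
         (δʳ A B C ⊙₁ id {D}) ∘ δˡ (A ⊙₀ B) C D
         ≡ ᾱ A (B ⊗₀ C) D ∘ (id {A} ⊙₁ δˡ B C D) ∘ δʳ A B (C ⊙₀ D)
    P7 : ∀ A B C D →
         δʳ (A ⊙₀ B) C D ∘ (ᾱ A B C ⊗₁ id {D})
         ≡ ᾱ A B (C ⊗₀ D) ∘ (id {A} ⊙₁ δʳ B C D) ∘ δʳ A (B ⊙₀ C) D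
    P8 : ∀ A B C D →
         ᾱ (A ⊙₀ B) C D ∘ ᾱ A B (C ⊙₀ D)
         ≡ (ᾱ A B C ⊙₁ id {D}) ∘ ᾱ A (B ⊙₀ C) D ∘ (id {A} ⊙₁ ᾱ B C D)

record Tidy {o m} (C : LDCat o m) : Set o where
  open LDCat C
  field
    ⊗-inj₁ : ∀ {A₁ A₂ B₁ B₂} → A₁ ⊗₀ A₂ ≡ B₁ ⊗₀ B₂ → A₁ ≡ B₁
    ⊗-inj₂ : ∀ {A₁ A₂ B₁ B₂} → A₁ ⊗₀ A₂ ≡ B₁ ⊗₀ B₂ → A₂ ≡ B₂
    ⊙-inj₁ : ∀ {A₁ A₂ B₁ B₂} → A₁ ⊙₀ A₂ ≡ B₁ ⊙₀ B₂ → A₁ ≡ B₁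
    ⊙-inj₂ : ∀ {A₁ A₂ B₁ B₂} → A₁ ⊙₀ A₂ ≡ B₁ ⊙₀ B₂ → A₂ ≡ B₂
    ⊗≢⊙    : ∀ {A₁ A₂ B₁ B₂} → A₁ ⊗₀ A₂ ≡ B₁ ⊙₀ B₂ → ⊥

-- The free monoid 𝔜 on the letters α, α⁻¹.  A word is a list whose
-- head is the letter applied last: u = ter(u) ∷ init(u).

data Letter : Set where
  aα aα⁻¹ : Letter

𝔜 : Set
𝔜 = List Letter

module Constructions {o m : Level} (C : LDCat o m) where
  open LDCat C

  -- morphisms packed with their source and target ("arrows"),
  -- so that morphisms with different (co)domains can be compared
  Arr : Set (o ⊔ m)
  Arr = Σ Obj λ X → Σ Obj λ Y → Hom X Y

  ⟨_⟩ : ∀ {X Y} → Hom X Y → Arr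
  ⟨_⟩ {X} {Y} g = X , Y , g

  module _ {H L R : Obj} (f : Hom H (L ⊗₀ R)) where
    Hᶠ : (u : 𝔜) → Vec Obj (length u) → Obj
    Lᶠ : (u : 𝔜) → Vec Obj (length u) → Obj
    Rᶠ : (u : 𝔜) → Vec Obj (length u) → Obj
    Hᶠ []          []       = H
    Hᶠ (aα ∷ u)    (A ∷ As) = A ⊗₀ Hᶠ u As
    Hᶠ (aα⁻¹ ∷ u)  As       = Hᶠ u (init As) ⊗₀ last As
    Lᶠ []          []       = L
    Lᶠ (aα ∷ u)    (A ∷ As) = A ⊗₀ Lᶠ u As
    Lᶠ (aα⁻¹ ∷ u)  As       = Lᶠ u (init As)
    Rᶠ []          []       = R
    Rᶠ (aα ∷ u)    (A ∷ As) = Rᶠ u As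
    Rᶠ (aα⁻¹ ∷ u)  As       = Rᶠ u (init As) ⊗₀ last As

    τᶠ : (u : 𝔜) (As : Vec Obj (length u)) → Hom (Hᶠ u As) (Lᶠ u As ⊗₀ Rᶠ u As)
    τᶠ []         []       = f
    τᶠ (aα ∷ u)   (A ∷ As) = α A (Lᶠ u As) (Rᶠ u As) ∘ (id {A} ⊗₁ τᶠ u As)
    τᶠ (aα⁻¹ ∷ u) As       =
      α⁻¹ (Lᶠ u (init As)) (Rᶠ u (init As)) (last As) ∘ (τᶠ u (init As) ⊗₁ id {last As})

  MorSet : (p : Level) → Set (o ⊔ m ⊔ suc p)
  MorSet p = ∀ {H L R : Obj} → Hom H (L ⊗₀ R) → Set p

  Analysable : ∀ {p} → MorSet p → ∀ {X Y} → Hom X Y → Set (o ⊔ m ⊔ p)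
  Analysable 𝔣 g =
    ∃[ H ] ∃[ L ] ∃[ R ] Σ (Hom H (L ⊗₀ R)) λ f' → 𝔣 f' ×
    Σ 𝔜 λ v → Σ (Vec Obj (length v)) λ B →
    ∃[ Y₁ ] ∃[ Y₂ ] Σ (Hom (Lᶠ f' v B) Y₁) λ g' → Σ (Hom (Rᶠ f' v B) Y₂) λ g'' →
    ⟨ g ⟩ ≡ ⟨ (g' ⊗₁ g'') ∘ τᶠ f' v B ⟩

-- For non-empty u the object H^f_u(A) is a ⊗-product, so by tidiness h cannot share its
-- codomain with a morphism into a ⊙-product. In every other case tidiness determines the
-- shape of h and of the objects A, and naturality of α together with the pentagon (P1)
-- rewrites τ^f_u(A) ∘ h as (g′ ⊗ g″) ∘ τ^f_v(B) for another word v, e.g.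
-- τ_{αu}(P ⊗ Q, A) ∘ α = (α ⊗ id) ∘ τ_{ααu}(P, Q, A); this makes τ^f_u(A) ∘ h analysable
-- unless u = α⁻¹ (for h = α) or u = α (for h = α⁻¹). For (iii) and (iv), a factorisation
-- of τ^f_{init u} ∘ h′ lifts by naturality along t ↦ α ∘ (id ⊗ t) and t ↦ α⁻¹ ∘ (t ⊗ id).

module Submission where

open import Defs
open import Level using (_⊔_)
open import Data.List using ([]; _∷_; length)
open import Data.Vec using (Vec; tail; init; last; _∷ʳ_; []; _∷_)
open import Data.Vec.Properties using (init-∷ʳ; last-∷ʳ)
open import Data.Product using (Σ; ∃-syntax; _×_; _,_)
open import Data.Empty using (⊥; ⊥-elim)
open import Relation.Binary.PropositionalEquality
  using (_≡_; refl; sym; trans; cong; cong₂; module ≡-Reasoning)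
open import Relation.Nullary using (¬_)

module LDCatProperties {o m} (C : LDCat o m) where
  open LDCat C
  open ≡-Reasoning

  iso-transpose : ∀ {P Q R S} {X : Hom Q R} {Y : Hom P Q} {Z : Hom S R} {W : Hom P S}
                  {X⁻¹ : Hom R Q} {W⁻¹ : Hom S P} →
                  X ∘ Y ≡ Z ∘ W → X⁻¹ ∘ X ≡ id → W ∘ W⁻¹ ≡ id → X⁻¹ ∘ Z ≡ Y ∘ W⁻¹
  iso-transpose {X = X} {Y} {Z} {W} {X⁻¹} {W⁻¹} XY≡ZW X⁻¹X≡id WW⁻¹≡id = begin
    X⁻¹ ∘ Z                   ≡⟨ sym (idʳ _) ⟩
    (X⁻¹ ∘ Z) ∘ id            ≡⟨ cong ((X⁻¹ ∘ Z) ∘_) (sym WW⁻¹≡id) ⟩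
    (X⁻¹ ∘ Z) ∘ (W ∘ W⁻¹)     ≡⟨ assoc _ _ _ ⟩
    X⁻¹ ∘ (Z ∘ (W ∘ W⁻¹))     ≡⟨ cong (X⁻¹ ∘_) (sym (assoc _ _ _)) ⟩
    X⁻¹ ∘ ((Z ∘ W) ∘ W⁻¹)     ≡⟨ cong (λ g → X⁻¹ ∘ (g ∘ W⁻¹)) (sym XY≡ZW) ⟩
    X⁻¹ ∘ ((X ∘ Y) ∘ W⁻¹)     ≡⟨ cong (X⁻¹ ∘_) (assoc _ _ _) ⟩
    X⁻¹ ∘ (X ∘ (Y ∘ W⁻¹))     ≡⟨ sym (assoc _ _ _) ⟩
    (X⁻¹ ∘ X) ∘ (Y ∘ W⁻¹)     ≡⟨ cong (_∘ (Y ∘ W⁻¹)) X⁻¹X≡id ⟩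
    id ∘ (Y ∘ W⁻¹)            ≡⟨ idˡ _ ⟩
    Y ∘ W⁻¹                   ∎

  ∘-inverse : ∀ {P Q R} {a : Hom Q R} {a⁻¹ : Hom R Q} {b : Hom P Q} {b⁻¹ : Hom Q P} →
              a⁻¹ ∘ a ≡ id → b⁻¹ ∘ b ≡ id → (b⁻¹ ∘ a⁻¹) ∘ (a ∘ b) ≡ id
  ∘-inverse {a = a} {a⁻¹} {b} {b⁻¹} a⁻¹a≡id b⁻¹b≡id = begin
    (b⁻¹ ∘ a⁻¹) ∘ (a ∘ b)     ≡⟨ assoc _ _ _ ⟩
    b⁻¹ ∘ (a⁻¹ ∘ (a ∘ b))     ≡⟨ cong (b⁻¹ ∘_) (sym (assoc _ _ _)) ⟩
    b⁻¹ ∘ ((a⁻¹ ∘ a) ∘ b)     ≡⟨ cong (λ g → b⁻¹ ∘ (g ∘ b)) a⁻¹a≡id ⟩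
    b⁻¹ ∘ (id ∘ b)            ≡⟨ cong (b⁻¹ ∘_) (idˡ b) ⟩
    b⁻¹ ∘ b                   ≡⟨ b⁻¹b≡id ⟩
    id                        ∎

  ⊗-inverse : ∀ {A B D E} {f : Hom B A} {g : Hom A B} {f′ : Hom E D} {g′ : Hom D E} →
              f ∘ g ≡ id → f′ ∘ g′ ≡ id → (f ⊗₁ f′) ∘ (g ⊗₁ g′) ≡ id
  ⊗-inverse {f = f} {g} {f′} {g′} fg≡id f′g′≡id =
    trans (sym (⊗-∘ f g f′ g′)) (trans (cong₂ _⊗₁_ fg≡id f′g′≡id) ⊗-id)

  id⊗-∘ : ∀ {A B D Z} (f : Hom B D) (g : Hom A B) → id {Z} ⊗₁ (f ∘ g) ≡ (id ⊗₁ f) ∘ (id ⊗₁ g)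
  id⊗-∘ f g = trans (cong (_⊗₁ (f ∘ g)) (sym (idˡ id))) (⊗-∘ id id f g)

  ∘-⊗id : ∀ {A B D Z} (f : Hom B D) (g : Hom A B) → (f ∘ g) ⊗₁ id {Z} ≡ (f ⊗₁ id) ∘ (g ⊗₁ id)
  ∘-⊗id f g = trans (cong ((f ∘ g) ⊗₁_) (sym (idˡ id))) (⊗-∘ f g id id)

  ⊗-idˡ : ∀ {A B X} (g : Hom X (A ⊗₀ B)) → (id ⊗₁ id) ∘ g ≡ g
  ⊗-idˡ g = trans (cong (_∘ g) ⊗-id) (idˡ g)

  α⁻¹-nat : ∀ {A A′ B B′ D D′} (f : Hom A A′) (g : Hom B B′) (h : Hom D D′) →
            α⁻¹ A′ B′ D′ ∘ ((f ⊗₁ g) ⊗₁ h) ≡ (f ⊗₁ (g ⊗₁ h)) ∘ α⁻¹ A B D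
  α⁻¹-nat f g h = iso-transpose (α-nat f g h) (α⁻¹∘α _ _ _) (α∘α⁻¹ _ _ _)

  P1-transpose₁ : ∀ A B D E →
    α⁻¹ (A ⊗₀ B) D E ∘ ((α A B D ⊗₁ id {E}) ∘ α A (B ⊗₀ D) E)
    ≡ α A B (D ⊗₀ E) ∘ (id {A} ⊗₁ α⁻¹ B D E)
  P1-transpose₁ A B D E =
    iso-transpose (trans (P1 A B D E) (sym (assoc _ _ _)))
      (α⁻¹∘α _ _ _) (⊗-inverse (idˡ id) (α∘α⁻¹ B D E))

  P1-transpose₂ : ∀ A B D E →
    (α⁻¹ A (B ⊗₀ D) E ∘ (α⁻¹ A B D ⊗₁ id {E})) ∘ α (A ⊗₀ B) D E
    ≡ (id {A} ⊗₁ α B D E) ∘ α⁻¹ A B (D ⊗₀ E)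
  P1-transpose₂ A B D E =
    iso-transpose (sym (trans (P1 A B D E) (sym (assoc _ _ _))))
      (∘-inverse (⊗-inverse (α⁻¹∘α A B D) (idˡ id)) (α⁻¹∘α _ _ _)) (α∘α⁻¹ _ _ _)

  -- τᶠ f (aα ∷ u) (A ∷ As) is A ◃ τᶠ f u As and τᶠ f (aα⁻¹ ∷ u) As is
  -- τᶠ f u (init As) ▹ last As, definitionally.
  infixr 15 _◃_
  infixl 15 _▹_

  _◃_ : ∀ {H L R} (A : Obj) → Hom H (L ⊗₀ R) → Hom (A ⊗₀ H) ((A ⊗₀ L) ⊗₀ R)
  _◃_ {L = L} {R} A t = α A L R ∘ (id ⊗₁ t)

  _▹_ : ∀ {H L R} → Hom H (L ⊗₀ R) → (x : Obj) → Hom (H ⊗₀ x) (L ⊗₀ (R ⊗₀ x))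
  _▹_ {L = L} {R} t x = α⁻¹ L R x ∘ (t ⊗₁ id)

  module _ {H H′ L L′ R R′} {k : Hom H′ H} {t : Hom H (L ⊗₀ R)} {t₂ : Hom H′ (L′ ⊗₀ R′)}
           {g′ : Hom L′ L} {g″ : Hom R′ R} (t∘k≡g∘t₂ : t ∘ k ≡ (g′ ⊗₁ g″) ∘ t₂) where

    ◃-natural : ∀ {A A′} (a : Hom A A′) → A′ ◃ t ∘ (a ⊗₁ k) ≡ ((a ⊗₁ g′) ⊗₁ g″) ∘ A ◃ t₂
    ◃-natural {A} {A′} a = begin
      (α A′ L R ∘ (id ⊗₁ t)) ∘ (a ⊗₁ k)
        ≡⟨ assoc _ _ _ ⟩
      α A′ L R ∘ ((id ⊗₁ t) ∘ (a ⊗₁ k))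
        ≡⟨ cong (α A′ L R ∘_) (sym (⊗-∘ id a t k)) ⟩
      α A′ L R ∘ ((id ∘ a) ⊗₁ (t ∘ k))
        ≡⟨ cong (α A′ L R ∘_) (cong₂ _⊗₁_ (trans (idˡ a) (sym (idʳ a))) t∘k≡g∘t₂) ⟩
      α A′ L R ∘ ((a ∘ id) ⊗₁ ((g′ ⊗₁ g″) ∘ t₂))
        ≡⟨ cong (α A′ L R ∘_) (⊗-∘ a id (g′ ⊗₁ g″) t₂) ⟩
      α A′ L R ∘ ((a ⊗₁ (g′ ⊗₁ g″)) ∘ (id ⊗₁ t₂))
        ≡⟨ sym (assoc _ _ _) ⟩
      (α A′ L R ∘ (a ⊗₁ (g′ ⊗₁ g″))) ∘ (id ⊗₁ t₂)
        ≡⟨ cong (_∘ (id ⊗₁ t₂)) (α-nat a g′ g″) ⟩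
      (((a ⊗₁ g′) ⊗₁ g″) ∘ α A L′ R′) ∘ (id ⊗₁ t₂)
        ≡⟨ assoc _ _ _ ⟩
      ((a ⊗₁ g′) ⊗₁ g″) ∘ (α A L′ R′ ∘ (id ⊗₁ t₂)) ∎

    ▹-natural : ∀ {x x′} (b : Hom x x′) → t ▹ x′ ∘ (k ⊗₁ b) ≡ (g′ ⊗₁ (g″ ⊗₁ b)) ∘ t₂ ▹ x
    ▹-natural {x} {x′} b = begin
      (α⁻¹ L R x′ ∘ (t ⊗₁ id)) ∘ (k ⊗₁ b)
        ≡⟨ assoc _ _ _ ⟩
      α⁻¹ L R x′ ∘ ((t ⊗₁ id) ∘ (k ⊗₁ b))
        ≡⟨ cong (α⁻¹ L R x′ ∘_) (sym (⊗-∘ t k id b)) ⟩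
      α⁻¹ L R x′ ∘ ((t ∘ k) ⊗₁ (id ∘ b))
        ≡⟨ cong (α⁻¹ L R x′ ∘_) (cong₂ _⊗₁_ t∘k≡g∘t₂ (trans (idˡ b) (sym (idʳ b)))) ⟩
      α⁻¹ L R x′ ∘ (((g′ ⊗₁ g″) ∘ t₂) ⊗₁ (b ∘ id))
        ≡⟨ cong (α⁻¹ L R x′ ∘_) (⊗-∘ (g′ ⊗₁ g″) t₂ b id) ⟩
      α⁻¹ L R x′ ∘ (((g′ ⊗₁ g″) ⊗₁ b) ∘ (t₂ ⊗₁ id))
        ≡⟨ sym (assoc _ _ _) ⟩
      (α⁻¹ L R x′ ∘ ((g′ ⊗₁ g″) ⊗₁ b)) ∘ (t₂ ⊗₁ id)
        ≡⟨ cong (_∘ (t₂ ⊗₁ id)) (α⁻¹-nat g′ g″ b) ⟩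
      ((g′ ⊗₁ (g″ ⊗₁ b)) ∘ α⁻¹ L′ R′ x) ∘ (t₂ ⊗₁ id)
        ≡⟨ assoc _ _ _ ⟩
      (g′ ⊗₁ (g″ ⊗₁ b)) ∘ (α⁻¹ L′ R′ x ∘ (t₂ ⊗₁ id)) ∎

  module _ {H L R} (t : Hom H (L ⊗₀ R)) where

    ◃-∘-α : ∀ P Q → (P ⊗₀ Q) ◃ t ∘ α P Q H ≡ (α P Q L ⊗₁ id) ∘ P ◃ Q ◃ t
    ◃-∘-α P Q = begin
      (α (P ⊗₀ Q) L R ∘ (id ⊗₁ t)) ∘ α P Q H
        ≡⟨ assoc _ _ _ ⟩
      α (P ⊗₀ Q) L R ∘ ((id ⊗₁ t) ∘ α P Q H)
        ≡⟨ cong (λ i → α (P ⊗₀ Q) L R ∘ ((i ⊗₁ t) ∘ α P Q H)) (sym ⊗-id) ⟩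
      α (P ⊗₀ Q) L R ∘ (((id ⊗₁ id) ⊗₁ t) ∘ α P Q H)
        ≡⟨ cong (α (P ⊗₀ Q) L R ∘_) (sym (α-nat id id t)) ⟩
      α (P ⊗₀ Q) L R ∘ (α P Q (L ⊗₀ R) ∘ (id ⊗₁ (id ⊗₁ t)))
        ≡⟨ sym (assoc _ _ _) ⟩
      (α (P ⊗₀ Q) L R ∘ α P Q (L ⊗₀ R)) ∘ (id ⊗₁ (id ⊗₁ t))
        ≡⟨ cong (_∘ (id ⊗₁ (id ⊗₁ t))) (P1 P Q L R) ⟩
      ((α P Q L ⊗₁ id) ∘ (α P (Q ⊗₀ L) R ∘ (id ⊗₁ α Q L R))) ∘ (id ⊗₁ (id ⊗₁ t))
        ≡⟨ assoc _ _ _ ⟩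
      (α P Q L ⊗₁ id) ∘ ((α P (Q ⊗₀ L) R ∘ (id ⊗₁ α Q L R)) ∘ (id ⊗₁ (id ⊗₁ t)))
        ≡⟨ cong ((α P Q L ⊗₁ id) ∘_) (assoc _ _ _) ⟩
      (α P Q L ⊗₁ id) ∘ (α P (Q ⊗₀ L) R ∘ ((id ⊗₁ α Q L R) ∘ (id ⊗₁ (id ⊗₁ t))))
        ≡⟨ cong (λ g → (α P Q L ⊗₁ id) ∘ (α P (Q ⊗₀ L) R ∘ g)) (sym (id⊗-∘ _ _)) ⟩
      (α P Q L ⊗₁ id) ∘ (α P (Q ⊗₀ L) R ∘ (id ⊗₁ (α Q L R ∘ (id ⊗₁ t)))) ∎

    [◃]▹-∘-α : ∀ B x → (B ◃ t) ▹ x ∘ α B H x ≡ B ◃ (t ▹ x)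
    [◃]▹-∘-α B x = begin
      (α⁻¹ (B ⊗₀ L) R x ∘ ((α B L R ∘ (id ⊗₁ t)) ⊗₁ id)) ∘ α B H x
        ≡⟨ assoc _ _ _ ⟩
      α⁻¹ (B ⊗₀ L) R x ∘ (((α B L R ∘ (id ⊗₁ t)) ⊗₁ id) ∘ α B H x)
        ≡⟨ cong (λ g → α⁻¹ (B ⊗₀ L) R x ∘ (g ∘ α B H x)) (∘-⊗id _ _) ⟩
      α⁻¹ (B ⊗₀ L) R x ∘ (((α B L R ⊗₁ id) ∘ ((id ⊗₁ t) ⊗₁ id)) ∘ α B H x)
        ≡⟨ cong (α⁻¹ (B ⊗₀ L) R x ∘_) (assoc _ _ _) ⟩
      α⁻¹ (B ⊗₀ L) R x ∘ ((α B L R ⊗₁ id) ∘ (((id ⊗₁ t) ⊗₁ id) ∘ α B H x))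
        ≡⟨ cong (λ g → α⁻¹ (B ⊗₀ L) R x ∘ ((α B L R ⊗₁ id) ∘ g)) (sym (α-nat id t id)) ⟩
      α⁻¹ (B ⊗₀ L) R x ∘ ((α B L R ⊗₁ id) ∘ (α B (L ⊗₀ R) x ∘ (id ⊗₁ (t ⊗₁ id))))
        ≡⟨ cong (α⁻¹ (B ⊗₀ L) R x ∘_) (sym (assoc _ _ _)) ⟩
      α⁻¹ (B ⊗₀ L) R x ∘ (((α B L R ⊗₁ id) ∘ α B (L ⊗₀ R) x) ∘ (id ⊗₁ (t ⊗₁ id)))
        ≡⟨ sym (assoc _ _ _) ⟩
      (α⁻¹ (B ⊗₀ L) R x ∘ ((α B L R ⊗₁ id) ∘ α B (L ⊗₀ R) x)) ∘ (id ⊗₁ (t ⊗₁ id))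
        ≡⟨ cong (_∘ (id ⊗₁ (t ⊗₁ id))) (P1-transpose₁ B L R x) ⟩
      (α B L (R ⊗₀ x) ∘ (id ⊗₁ α⁻¹ L R x)) ∘ (id ⊗₁ (t ⊗₁ id))
        ≡⟨ assoc _ _ _ ⟩
      α B L (R ⊗₀ x) ∘ ((id ⊗₁ α⁻¹ L R x) ∘ (id ⊗₁ (t ⊗₁ id)))
        ≡⟨ cong (α B L (R ⊗₀ x) ∘_) (sym (id⊗-∘ _ _)) ⟩
      α B L (R ⊗₀ x) ∘ (id ⊗₁ (α⁻¹ L R x ∘ (t ⊗₁ id))) ∎

    [▹]▹-∘-α : ∀ y x → (t ▹ y) ▹ x ∘ α H y x ≡ (id ⊗₁ α R y x) ∘ t ▹ (y ⊗₀ x)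
    [▹]▹-∘-α y x = begin
      (α⁻¹ L (R ⊗₀ y) x ∘ ((α⁻¹ L R y ∘ (t ⊗₁ id)) ⊗₁ id)) ∘ α H y x
        ≡⟨ assoc _ _ _ ⟩
      α⁻¹ L (R ⊗₀ y) x ∘ (((α⁻¹ L R y ∘ (t ⊗₁ id)) ⊗₁ id) ∘ α H y x)
        ≡⟨ cong (λ g → α⁻¹ L (R ⊗₀ y) x ∘ (g ∘ α H y x)) (∘-⊗id _ _) ⟩
      α⁻¹ L (R ⊗₀ y) x ∘ (((α⁻¹ L R y ⊗₁ id) ∘ ((t ⊗₁ id) ⊗₁ id)) ∘ α H y x)
        ≡⟨ cong (α⁻¹ L (R ⊗₀ y) x ∘_) (assoc _ _ _) ⟩
      α⁻¹ L (R ⊗₀ y) x ∘ ((α⁻¹ L R y ⊗₁ id) ∘ (((t ⊗₁ id) ⊗₁ id) ∘ α H y x))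
        ≡⟨ cong (λ g → α⁻¹ L (R ⊗₀ y) x ∘ ((α⁻¹ L R y ⊗₁ id) ∘ g)) (sym (α-nat t id id)) ⟩
      α⁻¹ L (R ⊗₀ y) x ∘ ((α⁻¹ L R y ⊗₁ id) ∘ (α (L ⊗₀ R) y x ∘ (t ⊗₁ (id ⊗₁ id))))
        ≡⟨ sym (assoc _ _ _) ⟩
      (α⁻¹ L (R ⊗₀ y) x ∘ (α⁻¹ L R y ⊗₁ id)) ∘ (α (L ⊗₀ R) y x ∘ (t ⊗₁ (id ⊗₁ id)))
        ≡⟨ sym (assoc _ _ _) ⟩
      ((α⁻¹ L (R ⊗₀ y) x ∘ (α⁻¹ L R y ⊗₁ id)) ∘ α (L ⊗₀ R) y x) ∘ (t ⊗₁ (id ⊗₁ id))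
        ≡⟨ cong₂ _∘_ (P1-transpose₂ L R y x) (cong (t ⊗₁_) ⊗-id) ⟩
      ((id ⊗₁ α R y x) ∘ α⁻¹ L R (y ⊗₀ x)) ∘ (t ⊗₁ id)
        ≡⟨ assoc _ _ _ ⟩
      (id ⊗₁ α R y x) ∘ (α⁻¹ L R (y ⊗₀ x) ∘ (t ⊗₁ id)) ∎

    ◃[◃]-∘-α⁻¹ : ∀ A B → A ◃ B ◃ t ∘ α⁻¹ A B H ≡ (α⁻¹ A B L ⊗₁ id) ∘ (A ⊗₀ B) ◃ t
    ◃[◃]-∘-α⁻¹ A B =
      sym (iso-transpose (sym (◃-∘-α A B)) (⊗-inverse (α⁻¹∘α A B L) (idˡ id)) (α∘α⁻¹ A B H))

    ◃[▹]-∘-α⁻¹ : ∀ A y → A ◃ (t ▹ y) ∘ α⁻¹ A H y ≡ (A ◃ t) ▹ y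
    ◃[▹]-∘-α⁻¹ A y =
      sym (trans (sym (idˡ _))
        (iso-transpose (trans (idˡ _) (sym ([◃]▹-∘-α A y))) (idˡ id) (α∘α⁻¹ A H y)))

    ▹-∘-α⁻¹ : ∀ Q S → t ▹ (Q ⊗₀ S) ∘ α⁻¹ H Q S ≡ (id ⊗₁ α⁻¹ R Q S) ∘ (t ▹ Q) ▹ S
    ▹-∘-α⁻¹ Q S =
      sym (iso-transpose (sym ([▹]▹-∘-α Q S)) (⊗-inverse (idˡ id) (α⁻¹∘α R Q S)) (α∘α⁻¹ H Q S))

module Analysability {o m p} (C : LDCat o m) (𝔣 : Constructions.MorSet C p) where
  open LDCat C
  open Constructions C
  open LDCatProperties C

  SplitArr : Set (o ⊔ m)
  SplitArr = Σ Obj λ H → Σ Obj λ L → Σ Obj λ R → Hom H (L ⊗₀ R)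

  ⟪_⟫ : ∀ {H L R} → Hom H (L ⊗₀ R) → SplitArr
  ⟪_⟫ {H} {L} {R} t = H , L , R , t

  data IsTau : ∀ {H L R} → Hom H (L ⊗₀ R) → Set (o ⊔ m ⊔ p) where
    base     : ∀ {H L R} {f : Hom H (L ⊗₀ R)} → 𝔣 f → IsTau f
    α-step   : ∀ {H L R} {t : Hom H (L ⊗₀ R)} (A : Obj) → IsTau t → IsTau (A ◃ t)
    α⁻¹-step : ∀ {H L R} {t : Hom H (L ⊗₀ R)} → IsTau t → (x : Obj) → IsTau (t ▹ x)

  IsTau-τᶠ : ∀ {H L R} {f : Hom H (L ⊗₀ R)} → 𝔣 f → ∀ u A → IsTau (τᶠ f u A)
  IsTau-τᶠ f∈𝔣 []         []       = base f∈𝔣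
  IsTau-τᶠ f∈𝔣 (aα ∷ u)   (A ∷ As) = α-step A (IsTau-τᶠ f∈𝔣 u As)
  IsTau-τᶠ f∈𝔣 (aα⁻¹ ∷ u) As       = α⁻¹-step (IsTau-τᶠ f∈𝔣 u (init As)) (last As)

  IsTau⇒τᶠ : ∀ {H L R} {t : Hom H (L ⊗₀ R)} → IsTau t →
    ∃[ H′ ] ∃[ L′ ] ∃[ R′ ] Σ (Hom H′ (L′ ⊗₀ R′)) λ f → 𝔣 f ×
    Σ 𝔜 λ v → Σ (Vec Obj (length v)) λ B → ⟪ t ⟫ ≡ ⟪ τᶠ f v B ⟫
  IsTau⇒τᶠ (base f∈𝔣) = _ , _ , _ , _ , f∈𝔣 , [] , [] , refl
  IsTau⇒τᶠ (α-step A p) with IsTau⇒τᶠ p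
  ... | _ , _ , _ , f , f∈𝔣 , v , B , t≡τ =
    _ , _ , _ , f , f∈𝔣 , aα ∷ v , A ∷ B , cong (λ (_ , _ , _ , t) → ⟪ A ◃ t ⟫) t≡τ
  IsTau⇒τᶠ (α⁻¹-step p x) with IsTau⇒τᶠ p
  ... | _ , _ , _ , f , f∈𝔣 , v , B , t≡τ =
    _ , _ , _ , f , f∈𝔣 , aα⁻¹ ∷ v , B ∷ʳ x ,
    trans (cong (λ (_ , _ , _ , t) → ⟪ t ▹ x ⟫) t≡τ)
          (cong₂ (λ B y → ⟪ τᶠ f v B ▹ y ⟫) (sym (init-∷ʳ x B)) (sym (last-∷ʳ x B)))

  analysable : ∀ {X L R Y₁ Y₂} {g : Hom X (Y₁ ⊗₀ Y₂)} {t : Hom X (L ⊗₀ R)}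
               {g′ : Hom L Y₁} {g″ : Hom R Y₂} →
               IsTau t → g ≡ (g′ ⊗₁ g″) ∘ t → Analysable 𝔣 g
  analysable p g≡g∘t with IsTau⇒τᶠ p
  ... | _ , _ , _ , f , f∈𝔣 , v , B , refl =
    _ , _ , _ , f , f∈𝔣 , v , B , _ , _ , _ , _ , cong ⟨_⟩ g≡g∘t

  analysable-IsTau : ∀ {X L R} {g t : Hom X (L ⊗₀ R)} → IsTau t → g ≡ t → Analysable 𝔣 g
  analysable-IsTau p g≡t = analysable p (trans g≡t (sym (⊗-idˡ _)))

  record Factorisation {X Y₁ Y₂} (g : Hom X (Y₁ ⊗₀ Y₂)) : Set (o ⊔ m ⊔ p) where
    constructor factorisation
    field
      {L R}   : Obj
      t       : Hom X (L ⊗₀ R)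
      isTau   : IsTau t
      left    : Hom L Y₁
      right   : Hom R Y₂
      factors : g ≡ (left ⊗₁ right) ∘ t

  factorisation⇒analysable : ∀ {X Y₁ Y₂} {g : Hom X (Y₁ ⊗₀ Y₂)} → Factorisation g → Analysable 𝔣 g
  factorisation⇒analysable (factorisation _ p _ _ g≡g∘t) = analysable p g≡g∘t

  ⟨⟩-injective : ∀ {X Y} {g g′ : Hom X Y} → ⟨ g ⟩ ≡ ⟨ g′ ⟩ → g ≡ g′
  ⟨⟩-injective refl = refl

  dom-≡ : ∀ {X Y X′ Y′} {g : Hom X Y} {g′ : Hom X′ Y′} → ⟨ g ⟩ ≡ ⟨ g′ ⟩ → X ≡ X′
  dom-≡ refl = refl

  cod-≡ : ∀ {X Y X′ Y′} {g : Hom X Y} {g′ : Hom X′ Y′} → ⟨ g ⟩ ≡ ⟨ g′ ⟩ → Y ≡ Y′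
  cod-≡ refl = refl

  analysable⇒factorisation : Tidy C → ∀ {X Y₁ Y₂} {g : Hom X (Y₁ ⊗₀ Y₂)} →
                             Analysable 𝔣 g → Factorisation g
  analysable⇒factorisation tidy (_ , _ , _ , f , f∈𝔣 , v , B , _ , _ , g′ , g″ , g≡g∘τ)
    with dom-≡ g≡g∘τ | Tidy.⊗-inj₁ tidy (cod-≡ g≡g∘τ) | Tidy.⊗-inj₂ tidy (cod-≡ g≡g∘τ)
  ... | refl | refl | refl =
    factorisation (τᶠ f v B) (IsTau-τᶠ f∈𝔣 v B) g′ g″ (⟨⟩-injective g≡g∘τ)

  factorisation-id : ∀ {X L R} {t : Hom X (L ⊗₀ R)} → IsTau t → Factorisation (t ∘ id)
  factorisation-id {t = t} p = factorisation t p id id (trans (idʳ t) (sym (⊗-idˡ t)))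

  factorisation-◃ : ∀ {A A′ H H′ L R} {t : Hom H (L ⊗₀ R)} {k : Hom H′ H} (a : Hom A A′) →
                    Factorisation (t ∘ k) → Factorisation (A′ ◃ t ∘ (a ⊗₁ k))
  factorisation-◃ {A} a (factorisation t₂ p g′ g″ t∘k≡g∘t₂) =
    factorisation (A ◃ t₂) (α-step A p) (a ⊗₁ g′) g″ (◃-natural t∘k≡g∘t₂ a)

  factorisation-▹ : ∀ {x x′ H H′ L R} {t : Hom H (L ⊗₀ R)} {k : Hom H′ H} (b : Hom x x′) →
                    Factorisation (t ∘ k) → Factorisation (t ▹ x′ ∘ (k ⊗₁ b))
  factorisation-▹ {x} b (factorisation t₂ p g′ g″ t∘k≡g∘t₂) =
    factorisation (t₂ ▹ x) (α⁻¹-step p x) g′ (g″ ⊗₁ b) (▹-natural t∘k≡g∘t₂ b)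

module Lemma3p11 {o m p} (C : LDCat o m) (tidy : Tidy C) (𝔣 : Constructions.MorSet C p) where
  open LDCat C
  open Constructions C
  open Tidy tidy
  open LDCatProperties C
  open Analysability C 𝔣

  module Parts {H L R} {f : Hom H (L ⊗₀ R)} (f∈𝔣 : 𝔣 f) where

    τ∈ : ∀ u A → IsTau (τᶠ f u A)
    τ∈ = IsTau-τᶠ f∈𝔣

    codomain-not-⊙ : ∀ m₀ u′ A {X X′ P Q} (h : Hom X (Hᶠ f (m₀ ∷ u′) A)) {g : Hom X′ (P ⊙₀ Q)} →
                     ⟨ h ⟩ ≡ ⟨ g ⟩ → ⊥
    codomain-not-⊙ aα   u′ (_ ∷ _) h h≡g = ⊗≢⊙ (cod-≡ h≡g)
    codomain-not-⊙ aα⁻¹ u′ A       h h≡g = ⊗≢⊙ (cod-≡ h≡g)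

    -- Stated for τᶠ f u B ▹ x with x a variable, so that the object equations obtained
    -- from tidiness can be solved by matching (they could not be for last A).
    α-component-▹ : ∀ u B x {X} (h : Hom X (Hᶠ f u B ⊗₀ x)) → ¬ Analysable 𝔣 (τᶠ f u B ▹ x ∘ h) →
                    ∀ P Q S → ⟨ h ⟩ ≡ ⟨ α P Q S ⟩ → u ≡ []
    α-component-▹ [] [] x h na P Q S h≡α = refl
    α-component-▹ (aα ∷ u) (B₁ ∷ Bs) x h na P Q S h≡α
      with ⊗-inj₁ (⊗-inj₁ (cod-≡ h≡α)) | ⊗-inj₂ (⊗-inj₁ (cod-≡ h≡α)) | ⊗-inj₂ (cod-≡ h≡α) | h≡α
    ... | refl | refl | refl | refl =
      ⊥-elim (na (analysable-IsTau (α-step B₁ (α⁻¹-step (τ∈ u Bs) x)) ([◃]▹-∘-α _ B₁ x)))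
    α-component-▹ (aα⁻¹ ∷ u) B x h na P Q S h≡α
      with ⊗-inj₁ (⊗-inj₁ (cod-≡ h≡α)) | ⊗-inj₂ (⊗-inj₁ (cod-≡ h≡α)) | ⊗-inj₂ (cod-≡ h≡α) | h≡α
    ... | refl | refl | refl | refl =
      ⊥-elim (na (analysable (α⁻¹-step (τ∈ u (init B)) (last B ⊗₀ x)) ([▹]▹-∘-α _ (last B) x)))

    α-component : ∀ m₀ u′ A {X} (h : Hom X (Hᶠ f (m₀ ∷ u′) A)) →
                  ¬ Analysable 𝔣 (τᶠ f (m₀ ∷ u′) A ∘ h) →
                  ∀ P Q S → ⟨ h ⟩ ≡ ⟨ α P Q S ⟩ → m₀ ∷ u′ ≡ aα⁻¹ ∷ []
    α-component aα u′ (A₁ ∷ As) h na P Q S h≡α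
      with ⊗-inj₁ (cod-≡ h≡α) | ⊗-inj₂ (cod-≡ h≡α) | h≡α
    ... | refl | refl | refl =
      ⊥-elim (na (analysable (α-step P (α-step Q (τ∈ u′ As))) (◃-∘-α _ P Q)))
    α-component aα⁻¹ u′ A h na P Q S h≡α =
      cong (aα⁻¹ ∷_) (α-component-▹ u′ (init A) (last A) h na P Q S h≡α)

    α⁻¹-component-▹ : ∀ u B x {X} (h : Hom X (Hᶠ f u B ⊗₀ x)) → ¬ Analysable 𝔣 (τᶠ f u B ▹ x ∘ h) →
                      ∀ P Q S → ⟨ h ⟩ ≡ ⟨ α⁻¹ P Q S ⟩ → ⊥
    α⁻¹-component-▹ u B x h na P Q S h≡α⁻¹
      with ⊗-inj₁ (cod-≡ h≡α⁻¹) | ⊗-inj₂ (cod-≡ h≡α⁻¹) | h≡α⁻¹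
    ... | refl | refl | refl =
      na (analysable (α⁻¹-step (α⁻¹-step (τ∈ u B) Q) S) (▹-∘-α⁻¹ _ Q S))

    α⁻¹-component : ∀ m₀ u′ A {X} (h : Hom X (Hᶠ f (m₀ ∷ u′) A)) →
                    ¬ Analysable 𝔣 (τᶠ f (m₀ ∷ u′) A ∘ h) →
                    ∀ P Q S → ⟨ h ⟩ ≡ ⟨ α⁻¹ P Q S ⟩ → m₀ ∷ u′ ≡ aα ∷ []
    α⁻¹-component aα [] (A₁ ∷ []) h na P Q S h≡α⁻¹ = refl
    α⁻¹-component aα (aα ∷ u) (A₁ ∷ B₁ ∷ Bs) h na P Q S h≡α⁻¹
      with ⊗-inj₁ (cod-≡ h≡α⁻¹) | ⊗-inj₁ (⊗-inj₂ (cod-≡ h≡α⁻¹)) | ⊗-inj₂ (⊗-inj₂ (cod-≡ h≡α⁻¹))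
         | h≡α⁻¹
    ... | refl | refl | refl | refl =
      ⊥-elim (na (analysable (α-step (A₁ ⊗₀ B₁) (τ∈ u Bs)) (◃[◃]-∘-α⁻¹ _ A₁ B₁)))
    α⁻¹-component aα (aα⁻¹ ∷ u) (A₁ ∷ As) h na P Q S h≡α⁻¹
      with ⊗-inj₁ (cod-≡ h≡α⁻¹) | ⊗-inj₁ (⊗-inj₂ (cod-≡ h≡α⁻¹)) | ⊗-inj₂ (⊗-inj₂ (cod-≡ h≡α⁻¹))
         | h≡α⁻¹
    ... | refl | refl | refl | refl =
      ⊥-elim (na (analysable-IsTau (α⁻¹-step (α-step A₁ (τ∈ u (init As))) (last As))
                                   (◃[▹]-∘-α⁻¹ _ A₁ (last As))))
    α⁻¹-component aα⁻¹ u′ A h na P Q S h≡α⁻¹ =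
      ⊥-elim (α⁻¹-component-▹ u′ (init A) (last A) h na P Q S h≡α⁻¹)

    id⊗-component : ∀ m₀ u′ A {X} (h : Hom X (Hᶠ f (m₀ ∷ u′) A)) →
                    ¬ Analysable 𝔣 (τᶠ f (m₀ ∷ u′) A ∘ h) →
                    ∀ {Z Z₁ Z₂} (h′ : Hom Z₁ Z₂) → ⟨ h ⟩ ≡ ⟨ id {Z} ⊗₁ h′ ⟩ →
                    m₀ ≡ aα × (∀ (k : Hom Z₁ (Hᶠ f u′ (tail A))) → ⟨ k ⟩ ≡ ⟨ h′ ⟩ →
                                 ¬ Analysable 𝔣 (τᶠ f u′ (tail A) ∘ k))
    id⊗-component aα u′ (A₁ ∷ As) h na h′ h≡id⊗h′
      with ⊗-inj₁ (cod-≡ h≡id⊗h′) | ⊗-inj₂ (cod-≡ h≡id⊗h′) | h≡id⊗h′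
    ... | refl | refl | refl = refl , λ { k refl an →
      na (factorisation⇒analysable (factorisation-◃ id (analysable⇒factorisation tidy an))) }
    id⊗-component aα⁻¹ u′ A h na h′ h≡id⊗h′
      with ⊗-inj₁ (cod-≡ h≡id⊗h′) | ⊗-inj₂ (cod-≡ h≡id⊗h′) | h≡id⊗h′
    ... | refl | refl | refl =
      ⊥-elim (na (factorisation⇒analysable
                    (factorisation-▹ h′ (factorisation-id (τ∈ u′ (init A))))))

    ⊗id-component : ∀ m₀ u′ A {X} (h : Hom X (Hᶠ f (m₀ ∷ u′) A)) →
                    ¬ Analysable 𝔣 (τᶠ f (m₀ ∷ u′) A ∘ h) →
                    ∀ {Z Z₁ Z₂} (h′ : Hom Z₁ Z₂) → ⟨ h ⟩ ≡ ⟨ h′ ⊗₁ id {Z} ⟩ →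
                    m₀ ≡ aα⁻¹ × (∀ (k : Hom Z₁ (Hᶠ f u′ (init A))) → ⟨ k ⟩ ≡ ⟨ h′ ⟩ →
                                   ¬ Analysable 𝔣 (τᶠ f u′ (init A) ∘ k))
    ⊗id-component aα u′ (A₁ ∷ As) h na h′ h≡h′⊗id
      with ⊗-inj₁ (cod-≡ h≡h′⊗id) | ⊗-inj₂ (cod-≡ h≡h′⊗id) | h≡h′⊗id
    ... | refl | refl | refl =
      ⊥-elim (na (factorisation⇒analysable (factorisation-◃ h′ (factorisation-id (τ∈ u′ As)))))
    ⊗id-component aα⁻¹ u′ A h na h′ h≡h′⊗id
      with ⊗-inj₁ (cod-≡ h≡h′⊗id) | ⊗-inj₂ (cod-≡ h≡h′⊗id) | h≡h′⊗id
    ... | refl | refl | refl = refl , λ { k refl an →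
      na (factorisation⇒analysable (factorisation-▹ id (analysable⇒factorisation tidy an))) }

lemma3p11 : ∀ {o m p} (C : LDCat o m) → Tidy C →
    let open LDCat C
        open Constructions C
    in (𝔣 : MorSet p) →
       -- u = m₀ ∷ u' non-empty, ter(u) = m₀, init(u) = u'
       (m₀ : Letter) (u' : 𝔜) →
       {H L R : Obj} (f : Hom H (L ⊗₀ R)) → 𝔣 f →
       (A : Vec Obj (length (m₀ ∷ u'))) →
       {X : Obj} (h : Hom X (Hᶠ f (m₀ ∷ u') A)) →
       ¬ Analysable 𝔣 (τᶠ f (m₀ ∷ u') A ∘ h) →
       -- (i)
       ( ¬ (∃[ P ] ∃[ Q ] ∃[ S ] ⟨ h ⟩ ≡ ⟨ δˡ P Q S ⟩)
       × ¬ (∃[ P ] ∃[ Q ] ∃[ S ] ⟨ h ⟩ ≡ ⟨ δʳ P Q S ⟩)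
       × ¬ (∃[ P ] ∃[ Q ] ∃[ S ] ⟨ h ⟩ ≡ ⟨ ᾱ P Q S ⟩)
       × ¬ (∃[ P ] ∃[ Q ] ∃[ S ] ⟨ h ⟩ ≡ ⟨ ᾱ⁻¹ P Q S ⟩)
       × ¬ (∃[ Z ] ∃[ Z₁ ] ∃[ Z₂ ] Σ (Hom Z₁ Z₂) λ h' → ⟨ h ⟩ ≡ ⟨ id {Z} ⊙₁ h' ⟩)
       × ¬ (∃[ Z ] ∃[ Z₁ ] ∃[ Z₂ ] Σ (Hom Z₁ Z₂) λ h' → ⟨ h ⟩ ≡ ⟨ h' ⊙₁ id {Z} ⟩) )
       -- (ii)
       × ( (∀ P Q S → ⟨ h ⟩ ≡ ⟨ α P Q S ⟩ → m₀ ∷ u' ≡ aα⁻¹ ∷ [])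
         × (∀ P Q S → ⟨ h ⟩ ≡ ⟨ α⁻¹ P Q S ⟩ → m₀ ∷ u' ≡ aα ∷ []) )
       -- (iii)
       × (∀ {Z Z₁ Z₂} (h' : Hom Z₁ Z₂) → ⟨ h ⟩ ≡ ⟨ id {Z} ⊗₁ h' ⟩ →
            m₀ ≡ aα
            × (∀ (k : Hom Z₁ (Hᶠ f u' (tail A))) → ⟨ k ⟩ ≡ ⟨ h' ⟩ →
                 ¬ Analysable 𝔣 (τᶠ f u' (tail A) ∘ k)))
       -- (iv)
       × (∀ {Z Z₁ Z₂} (h' : Hom Z₁ Z₂) → ⟨ h ⟩ ≡ ⟨ h' ⊗₁ id {Z} ⟩ →
            m₀ ≡ aα⁻¹
            × (∀ (k : Hom Z₁ (Hᶠ f u' (init A))) → ⟨ k ⟩ ≡ ⟨ h' ⟩ →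
                 ¬ Analysable 𝔣 (τᶠ f u' (init A) ∘ k)))
lemma3p11 C tidy 𝔣 m₀ u′ _ f∈𝔣 A h na =
    ( (λ (_ , _ , _ , h≡g) → codomain-not-⊙ m₀ u′ A h h≡g)
    , (λ (_ , _ , _ , h≡g) → codomain-not-⊙ m₀ u′ A h h≡g)
    , (λ (_ , _ , _ , h≡g) → codomain-not-⊙ m₀ u′ A h h≡g)
    , (λ (_ , _ , _ , h≡g) → codomain-not-⊙ m₀ u′ A h h≡g)
    , (λ (_ , _ , _ , _ , h≡g) → codomain-not-⊙ m₀ u′ A h h≡g)
    , (λ (_ , _ , _ , _ , h≡g) → codomain-not-⊙ m₀ u′ A h h≡g) )
  , (α-component m₀ u′ A h na , α⁻¹-component m₀ u′ A h na)
  , id⊗-component m₀ u′ A h na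
  , ⊗id-component m₀ u′ A h na
  where
  open Lemma3p11.Parts C tidy 𝔣 f∈𝔣
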